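{- Every bi-infinite binary word avoiding the formula $AA.ABAB.BB$ and the factor $\texttt{11}$ has the same set of finite factors as the period-doubling word ${\bf pd}$.
   Context: The period-doubling word ${\bf pd}$ is the fixed point starting with $\texttt{0}$ of the morphism $\texttt{0}\mapsto\texttt{01}$, $\texttt{1}\mapsto\texttt{00}$. A word $w$ contains an occurrence of the formula $AA.ABAB.BB$ if there is a non-erasing morphism $h$ from $\{A,B\}^*$ to binary words such that each of $h(AA)$, $h(ABAB)$ and $h(BB)$ is a factor of $w$ (not necessarily at related positions); $w$ avoids the formula if no such $h$ exists. -}

module Defs where

open import Data.Bool using (Bool; true; false)
open import Data.List using (List; []; _∷_; _++_; length; concatMap)
open import Data.Nat using (ℕ; zero; suc)
open import Data.Integer using (ℤ; +_; _+_)
open import Data.Product using (Σ; ∃; _×_)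
open import Relation.Nullary using (¬_)
open import Relation.Binary.PropositionalEquality using (_≡_)

-- Binary alphabet: false = letter 0, true = letter 1.
Word : Set
Word = List Bool

BiWord : Set
BiWord = ℤ → Bool

block : BiWord → ℤ → ℕ → Word
block w i zero    = []
block w i (suc n) = w i ∷ block w (i + + 1) n

FactorBi : Word → BiWord → Set
FactorBi u w = ∃ λ i → block w i (length u) ≡ u

σ-letter : Bool → Word
σ-letter false = false ∷ true ∷ []
σ-letter true  = false ∷ false ∷ []

σ : Word → Word
σ = concatMap σ-letter

σ^ : ℕ → Word → Word
σ^ zero    u = u
σ^ (suc k) u = σ (σ^ k u)

-- u is a factor of the period-doubling word pd, the fixed point of σ
-- starting with 0: pd is the limit of the prefixes σ^k(0), so its
-- finite factors are exactly the factors of the words σ^k(0).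
FactorPD : Word → Set
FactorPD u = ∃ λ k → Σ Word λ p → Σ Word λ s → p ++ u ++ s ≡ σ^ k (false ∷ [])

NonEmpty : Word → Set
NonEmpty u = ¬ (u ≡ [])

-- w contains an occurrence of the formula AA.ABAB.BB: there is a
-- non-erasing morphism h (determined by h(A) = a, h(B) = b, both
-- nonempty) such that h(AA), h(ABAB), h(BB) are all factors of w.
ContainsAAABABBB : BiWord → Set
ContainsAAABABBB w =
  Σ Word λ a → Σ Word λ b →
    NonEmpty a × NonEmpty b ×
    FactorBi (a ++ a) w ×
    FactorBi (a ++ b ++ a ++ b) w ×
    FactorBi (b ++ b) w

AvoidsAAABABBB : BiWord → Set
AvoidsAAABABBB w = ¬ ContainsAAABABBB w

-- An admissible word (one avoiding the formula and 11) avoids 0000, via h(A) = h(B) = 0,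
-- and 1001, because each of the 2¹⁰ two-sided extensions of 1001 by five letters contains
-- 11 or an occurrence of the formula under one of five short morphisms. So consecutive 1s
-- are two or four apart: all 1s sit at positions of one parity, the other parity class is
-- all 0s, and the word is σ(w′). The preimage w′ is admissible again, since σ sends 11 to
-- 0000 and occurrences of the formula to occurrences of the formula. Iterating, every
-- σᵏ(0) occurs in w. Conversely a factor u of w with |u| ≥ 3 lies inside σ(v) for a
-- factor v of w′ of length ⌊|u|/2⌋ + 1 < |u|, so by induction on |u| it is a factor of pd.
module Submission where

open import Defs
open import Data.Bool using (Bool; true; false; T; not; _∧_; _∨_)
open import Data.Bool.ListAction using (any)
open import Data.Bool.Properties using (T-∧; T-∨; T-not-≡) renaming (_≟_ to _≟ᵇ_)
open import Data.Empty using (⊥-elim)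
open import Data.Integer using (ℤ; +_; -[1+_]; _-_) renaming (_+_ to _+ᶻ_; _*_ to _*ᶻ_)
open import Data.Integer.DivMod using (_/ℕ_; _%ℕ_; a≡a%ℕn+[a/ℕn]*n; n%ℕd<d)
import Data.Integer.Properties as ℤ
open import Data.Integer.Tactic.RingSolver using (solve-∀)
open import Data.List using (List; []; _∷_; _++_; length)
open import Data.List.NonEmpty using (List⁺; _∷_; toList)
open import Data.List.Properties using (++-assoc; concatMap-++; ∷-injective)
open import Data.List.Relation.Binary.Infix.Heterogeneous using (Infix; MkView; toView)
open import Data.List.Relation.Binary.Infix.Heterogeneous.Properties using (infix?)
open import Data.List.Relation.Binary.Pointwise using (Pointwise-≡⇒≡)
open import Data.List.Relation.Unary.Any using (satisfied)
open import Data.List.Relation.Unary.Any.Properties using (any⁻)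
open import Data.Nat using (ℕ; zero; suc; _+_; _*_; _∸_; _≤_; _<_; z<s; s<s; s≤s⁻¹; ⌊_/2⌋)
open import Data.Nat.Induction using (<-rec)
import Data.Nat.Properties as ℕ
open import Data.Product using (∃; ∃₂; _×_; _,_; proj₁; proj₂)
open import Data.Sum using (_⊎_; inj₁; inj₂)
open import Function using (_∘_; Equivalence)
open import Relation.Binary.PropositionalEquality
open import Relation.Nullary using (¬_)
open import Relation.Nullary.Decidable using (⌊_⌋; toWitness)

open Equivalence using (to)

pattern O = false
pattern I = true

block-length : ∀ w i n → length (block w i n) ≡ n
block-length w i zero    = refl
block-length w i (suc n) = cong suc (block-length w (i +ᶻ + 1) n)

block-++ : ∀ w i m n → block w i (m + n) ≡ block w i m ++ block w (i +ᶻ + m) n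
block-++ w i zero    n = cong (λ k → block w k n) (sym (ℤ.+-identityʳ i))
block-++ w i (suc m) n = cong (w i ∷_) (begin
  block w (i +ᶻ + 1) (m + n)                            ≡⟨ block-++ w (i +ᶻ + 1) m n ⟩
  block w (i +ᶻ + 1) m ++ block w (i +ᶻ + 1 +ᶻ + m) n   ≡⟨ cong (λ k → block w (i +ᶻ + 1) m ++ block w k n)
                                                                (ℤ.+-assoc i (+ 1) (+ m)) ⟩
  block w (i +ᶻ + 1) m ++ block w (i +ᶻ + suc m) n      ∎)
  where open ≡-Reasoning

block-window : ∀ w i →
  block w i 5 ≡ w i ∷ w (i +ᶻ + 1) ∷ w (i +ᶻ + 2) ∷ w (i +ᶻ + 3) ∷ w (i +ᶻ + 4) ∷ []
block-window w i rewrite ℤ.+-assoc i (+ 1) (+ 1) | ℤ.+-assoc i (+ 2) (+ 1) | ℤ.+-assoc i (+ 3) (+ 1) = refl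

block-factor : ∀ w i n → FactorBi (block w i n) w
block-factor w i n = i , cong (block w i) (block-length w i n)

occurs-prefix : ∀ w i u s → block w i (length (u ++ s)) ≡ u ++ s → block w i (length u) ≡ u
occurs-prefix w i []      s e = refl
occurs-prefix w i (a ∷ u) s e with ∷-injective e
... | eᵃ , eᵘ = cong₂ _∷_ eᵃ (occurs-prefix w (i +ᶻ + 1) u s eᵘ)

occurs-suffix : ∀ w i p u → block w i (length (p ++ u)) ≡ p ++ u →
  block w (i +ᶻ + length p) (length u) ≡ u
occurs-suffix w i []      u e = trans (cong (λ k → block w k (length u)) (ℤ.+-identityʳ i)) e
occurs-suffix w i (a ∷ p) u e =
  trans (cong (λ k → block w k (length u)) (sym (ℤ.+-assoc i (+ 1) (+ length p))))
        (occurs-suffix w (i +ᶻ + 1) p u (proj₂ (∷-injective e)))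

factor-infix : ∀ {w} p u s → FactorBi (p ++ u ++ s) w → FactorBi u w
factor-infix {w} p u s (i , e) =
  i +ᶻ + length p , occurs-prefix w (i +ᶻ + length p) u s (occurs-suffix w i p (u ++ s) e)

infix-factor : ∀ {w u v} → Infix _≡_ u v → FactorBi v w → FactorBi u w
infix-factor u⊑v fv with toView u⊑v
... | MkView p u≡ s =
  factor-infix p _ s (subst (λ t → FactorBi (p ++ t ++ s) _) (sym (Pointwise-≡⇒≡ u≡)) fv)

infix 4 _⊑?_
_⊑?_ : Word → Word → Bool
u ⊑? v = ⌊ infix? _≟ᵇ_ u v ⌋

⊑?-factor : ∀ {w} u i n → T (u ⊑? block w i n) → FactorBi u w
⊑?-factor {w} u i n t = infix-factor (toWitness t) (block-factor w i n)

allOfLength : ℕ → (Word → Bool) → Bool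
allOfLength zero    p = p []
allOfLength (suc n) p = allOfLength n (p ∘ (O ∷_)) ∧ allOfLength n (p ∘ (I ∷_))

allOfLength-sound : ∀ n p → T (allOfLength n p) → ∀ u → length u ≡ n → T (p u)
allOfLength-sound zero    p t []      refl = t
allOfLength-sound (suc n) p t (O ∷ u) refl = allOfLength-sound n _ (proj₁ (to T-∧ t)) u refl
allOfLength-sound (suc n) p t (I ∷ u) refl = allOfLength-sound n _ (proj₂ (to T-∧ t)) u refl

Admissible : BiWord → Set
Admissible w = AvoidsAAABABBB w × ¬ FactorBi (I ∷ I ∷ []) w

formulaIn? : Word → Word → Word → Bool
formulaIn? a b v = (a ++ a ⊑? v) ∧ (a ++ b ++ a ++ b ⊑? v) ∧ (b ++ b ⊑? v)

smallMorphisms : List (List⁺ Bool × List⁺ Bool)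
smallMorphisms =
  (O ∷ [] , O ∷ []) ∷ (O ∷ I ∷ [] , O ∷ []) ∷ (O ∷ [] , O ∷ I ∷ O ∷ []) ∷
  (O ∷ I ∷ O ∷ [] , O ∷ []) ∷ (I ∷ O ∷ O ∷ [] , I ∷ O ∷ O ∷ []) ∷ []

forbidden? : Word → Bool
forbidden? v = (I ∷ I ∷ [] ⊑? v) ∨ any (λ (a , b) → formulaIn? (toList a) (toList b) v) smallMorphisms

formulaIn?-factors : ∀ {w} a b i n → T (formulaIn? a b (block w i n)) →
  FactorBi (a ++ a) w × FactorBi (a ++ b ++ a ++ b) w × FactorBi (b ++ b) w
formulaIn?-factors a b i n t with to T-∧ t
... | tᵃᵃ , t′ with to T-∧ t′
... | tᵃᵇᵃᵇ , tᵇᵇ = ⊑?-factor _ i n tᵃᵃ , ⊑?-factor _ i n tᵃᵇᵃᵇ , ⊑?-factor _ i n tᵇᵇ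

admissible⇒¬forbidden? : ∀ {w} → Admissible w → ∀ i n → ¬ T (forbidden? (block w i n))
admissible⇒¬forbidden? (_ , no-11) i n t with to T-∨ t
... | inj₁ t¹¹ = no-11 (⊑?-factor _ i n t¹¹)
admissible⇒¬forbidden? {w} (avoids , _) i n t | inj₂ tʰ
  with satisfied (any⁻ (λ (a , b) → formulaIn? (toList a) (toList b) (block w i n)) smallMorphisms tʰ)
... | (a₀ ∷ a , b₀ ∷ b) , tᵃᵇ =
  avoids (a₀ ∷ a , b₀ ∷ b , (λ ()) , (λ ()) , formulaIn?-factors (a₀ ∷ a) (b₀ ∷ b) i n tᵃᵇ)

no-0000 : ∀ {w} → Admissible w → ¬ FactorBi (O ∷ O ∷ O ∷ O ∷ []) w
no-0000 (avoids , _) f =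
  avoids (O ∷ [] , O ∷ [] , (λ ()) , (λ ()) , factor-infix [] _ _ f , f , factor-infix [] _ _ f)

extensions-of-1001-forbidden :
  T (allOfLength 5 λ l → allOfLength 5 λ r → forbidden? (l ++ I ∷ O ∷ O ∷ I ∷ [] ++ r))
extensions-of-1001-forbidden = _

no-1001 : ∀ {w} → Admissible w → ¬ FactorBi (I ∷ O ∷ O ∷ I ∷ []) w
no-1001 {w} adm (i , e) =
  admissible⇒¬forbidden? adm (i - + 5) 14 (subst (T ∘ forbidden?) (sym extension) forbidden)
  where
  l = block w (i - + 5) 5
  r = block w (i +ᶻ + 4) 5
  back : ∀ i → i - + 5 +ᶻ + 5 ≡ i
  back = solve-∀
  extension : block w (i - + 5) 14 ≡ l ++ I ∷ O ∷ O ∷ I ∷ [] ++ r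
  extension = begin
    block w (i - + 5) (5 + 9)                ≡⟨ block-++ w (i - + 5) 5 9 ⟩
    l ++ block w (i - + 5 +ᶻ + 5) (4 + 5)    ≡⟨ cong (λ k → l ++ block w k (4 + 5)) (back i) ⟩
    l ++ block w i (4 + 5)                   ≡⟨ cong (l ++_) (block-++ w i 4 5) ⟩
    l ++ block w i 4 ++ r                    ≡⟨ cong (λ m → l ++ m ++ r) e ⟩
    l ++ I ∷ O ∷ O ∷ I ∷ [] ++ r             ∎
    where open ≡-Reasoning
  forbidden : T (forbidden? (l ++ I ∷ O ∷ O ∷ I ∷ [] ++ r))
  forbidden = allOfLength-sound 5 (λ r → forbidden? (l ++ I ∷ O ∷ O ∷ I ∷ [] ++ r))
    (allOfLength-sound 5 (λ l → allOfLength 5 λ r → forbidden? (l ++ I ∷ O ∷ O ∷ I ∷ [] ++ r))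
      extensions-of-1001-forbidden l (block-length w (i - + 5) 5))
    r (block-length w (i +ᶻ + 4) 5)

windowRule : Word → Bool
windowRule (x₀ ∷ x₁ ∷ x₂ ∷ x₃ ∷ x₄ ∷ []) =
  ⌊ (x₀ ∨ x₂) ≟ᵇ (x₂ ∨ x₄) ⌋ ∧ not ((x₀ ∨ x₂) ∧ x₁) ∧ ((x₀ ∨ x₂) ∨ (x₁ ∨ x₃))
windowRule _ = false

-- Without 11, 1001 and 0000, consecutive 1s are exactly two or four apart.
windows-forbidden-or-ruled :
  T (allOfLength 5 λ v → forbidden? v ∨ (I ∷ O ∷ O ∷ I ∷ [] ⊑? v) ∨ windowRule v)
windows-forbidden-or-ruled = _

admissible⇒windowRule : ∀ {w} → Admissible w → ∀ i → T (windowRule (block w i 5))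
admissible⇒windowRule {w} adm i
  with to T-∨ (allOfLength-sound 5 (λ v → forbidden? v ∨ (I ∷ O ∷ O ∷ I ∷ [] ⊑? v) ∨ windowRule v)
                 windows-forbidden-or-ruled (block w i 5) (block-length w i 5))
... | inj₁ t = ⊥-elim (admissible⇒¬forbidden? adm i 5 t)
... | inj₂ t with to T-∨ t
...   | inj₁ t′ = ⊥-elim (no-1001 adm (⊑?-factor _ i 5 t′))
...   | inj₂ t′ = t′

windowRule-facts : ∀ x₀ x₁ x₂ x₃ x₄ → T (windowRule (x₀ ∷ x₁ ∷ x₂ ∷ x₃ ∷ x₄ ∷ [])) →
  (x₀ ∨ x₂ ≡ x₂ ∨ x₄) × (T (x₀ ∨ x₂) → x₁ ≡ O) × (T (x₀ ∨ x₂) ⊎ T (x₁ ∨ x₃))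
windowRule-facts x₀ x₁ x₂ x₃ x₄ t with to (T-∧ {⌊ (x₀ ∨ x₂) ≟ᵇ (x₂ ∨ x₄) ⌋}) t
... | periodic , t′ with to (T-∧ {not ((x₀ ∨ x₂) ∧ x₁)}) t′
... | gap , cover = toWitness periodic , gap′ (x₀ ∨ x₂) gap , to T-∨ cover
  where
  gap′ : ∀ a {b} → T (not (a ∧ b)) → T a → b ≡ O
  gap′ true g _ = to T-not-≡ g

-- marked w i: position i + 1 has a neighbouring 1. These positions will be the σ-block starts.
marked : BiWord → ℤ → Bool
marked w i = w i ∨ w (i +ᶻ + 2)

module _ {w : BiWord} (adm : Admissible w) where

  private
    window-facts : ∀ i →
      (marked w i ≡ w (i +ᶻ + 2) ∨ w (i +ᶻ + 4)) × (T (marked w i) → w (i +ᶻ + 1) ≡ O) ×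
      (T (marked w i) ⊎ T (w (i +ᶻ + 1) ∨ w (i +ᶻ + 3)))
    window-facts i = windowRule-facts (w i) (w (i +ᶻ + 1)) (w (i +ᶻ + 2)) (w (i +ᶻ + 3)) (w (i +ᶻ + 4))
      (subst (T ∘ windowRule) (block-window w i) (admissible⇒windowRule adm i))

  marked-periodic : ∀ i → marked w (i +ᶻ + 2) ≡ marked w i
  marked-periodic i rewrite ℤ.+-assoc i (+ 2) (+ 2) = sym (proj₁ (window-facts i))

  marked-gap : ∀ i → T (marked w i) → w (i +ᶻ + 1) ≡ O
  marked-gap i = proj₁ (proj₂ (window-facts i))

  marked-near-origin : T (marked w (+ 0)) ⊎ T (marked w (+ 1))
  marked-near-origin = proj₂ (proj₂ (window-facts (+ 0)))

ℤ-induction : (P : ℤ → Set) → P (+ 0) → (∀ j → P j → P (j +ᶻ + 1)) → (∀ j → P (j +ᶻ + 1) → P j) →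
  ∀ j → P j
ℤ-induction P base up down (+ zero)     = base
ℤ-induction P base up down (+ suc n)    =
  subst P (cong +_ (ℕ.+-comm n 1)) (up (+ n) (ℤ-induction P base up down (+ n)))
ℤ-induction P base up down -[1+ zero ]  = down -[1+ zero ] base
ℤ-induction P base up down -[1+ suc n ] = down -[1+ suc n ] (ℤ-induction P base up down -[1+ n ])

periodic⇒constant : ∀ {A : Set} (f : ℤ → A) p → (∀ i → f (i +ᶻ p) ≡ f i) →
  ∀ c j → f (c +ᶻ j *ᶻ p) ≡ f c
periodic⇒constant f p periodic c = ℤ-induction (λ j → f (c +ᶻ j *ᶻ p) ≡ f c)
  (cong f (ℤ.+-identityʳ c))
  (λ j e → trans (cong f (step c j p)) (trans (periodic _) e))
  (λ j e → trans (sym (periodic _)) (trans (cong f (sym (step c j p))) e))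
  where
  step : ∀ c j p → c +ᶻ (j +ᶻ + 1) *ᶻ p ≡ c +ᶻ j *ᶻ p +ᶻ p
  step = solve-∀

even-odd-split : ∀ b i → ∃₂ λ j o → o ≤ 1 × i ≡ b +ᶻ j *ᶻ + 2 +ᶻ + o
even-odd-split b i = q , r , s≤s⁻¹ (n%ℕd<d (i - b) 2) , (begin
  i                            ≡⟨ around b i ⟩
  b +ᶻ (i - b)                 ≡⟨ cong (b +ᶻ_) (a≡a%ℕn+[a/ℕn]*n (i - b) 2) ⟩
  b +ᶻ (+ r +ᶻ q *ᶻ + 2)       ≡⟨ regroup b (+ r) q ⟩
  b +ᶻ q *ᶻ + 2 +ᶻ + r         ∎)
  where
  open ≡-Reasoning
  q = (i - b) /ℕ 2
  r = (i - b) %ℕ 2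
  around : ∀ b i → i ≡ b +ᶻ (i - b)
  around = solve-∀
  regroup : ∀ b r q → b +ᶻ (r +ᶻ q *ᶻ + 2) ≡ b +ᶻ q *ᶻ + 2 +ᶻ r
  regroup = solve-∀

σ-letter-not : ∀ a → σ-letter (not a) ≡ O ∷ a ∷ []
σ-letter-not O = refl
σ-letter-not I = refl

σ-length : ∀ u → length (σ u) ≡ length u * 2
σ-length []      = refl
σ-length (O ∷ u) = cong (suc ∘ suc) (σ-length u)
σ-length (I ∷ u) = cong (suc ∘ suc) (σ-length u)

σ-++ : ∀ u v → σ (u ++ v) ≡ σ u ++ σ v
σ-++ = concatMap-++ σ-letter

σ-nonempty : ∀ {u} → NonEmpty u → NonEmpty (σ u)
σ-nonempty {[]}    u≢[] _ = u≢[] refl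
σ-nonempty {O ∷ u} _ ()
σ-nonempty {I ∷ u} _ ()

zeros⇒σ-blocks : ∀ w b → (∀ j → w (b +ᶻ j *ᶻ + 2) ≡ O) → ∀ j m →
  block w (b +ᶻ j *ᶻ + 2) (m * 2) ≡ σ (block (λ j → not (w (b +ᶻ j *ᶻ + 2 +ᶻ + 1))) j m)
zeros⇒σ-blocks w b zeros j zero    = refl
zeros⇒σ-blocks w b zeros j (suc m) = begin
  w p ∷ w (p +ᶻ + 1) ∷ block w (p +ᶻ + 1 +ᶻ + 1) (m * 2)
    ≡⟨ cong₂ (λ x k → x ∷ w (p +ᶻ + 1) ∷ block w k (m * 2)) (zeros j) (next b j) ⟩
  O ∷ w (p +ᶻ + 1) ∷ block w (b +ᶻ (j +ᶻ + 1) *ᶻ + 2) (m * 2)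
    ≡⟨ cong (λ v → O ∷ w (p +ᶻ + 1) ∷ v) (zeros⇒σ-blocks w b zeros (j +ᶻ + 1) m) ⟩
  O ∷ w (p +ᶻ + 1) ∷ σ (block w′ (j +ᶻ + 1) m)
    ≡⟨ cong (_++ σ (block w′ (j +ᶻ + 1) m)) (σ-letter-not (w (p +ᶻ + 1))) ⟨
  σ (block w′ j (suc m))
    ∎
  where
  open ≡-Reasoning
  p = b +ᶻ j *ᶻ + 2
  w′ = λ j → not (w (b +ᶻ j *ᶻ + 2 +ᶻ + 1))
  next : ∀ b j → b +ᶻ j *ᶻ + 2 +ᶻ + 1 +ᶻ + 1 ≡ b +ᶻ (j +ᶻ + 1) *ᶻ + 2
  next = solve-∀

n<[1+⌊n/2⌋]*2 : ∀ n → n < suc ⌊ n /2⌋ * 2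
n<[1+⌊n/2⌋]*2 zero          = z<s
n<[1+⌊n/2⌋]*2 (suc zero)    = s<s z<s
n<[1+⌊n/2⌋]*2 (suc (suc n)) = s<s (s<s (n<[1+⌊n/2⌋]*2 n))

record Desubstitution (w : BiWord) : Set where
  field
    offset   : ℤ
    preimage : BiWord
    σ-block  : ∀ j m → block w (offset +ᶻ j *ᶻ + 2) (m * 2) ≡ σ (block preimage j m)

module _ {w : BiWord} (D : Desubstitution w) where
  open Desubstitution D

  σ-factor : ∀ {u} → FactorBi u preimage → FactorBi (σ u) w
  σ-factor {u} (j , e) = offset +ᶻ j *ᶻ + 2 , (begin
    block w (offset +ᶻ j *ᶻ + 2) (length (σ u))    ≡⟨ cong (block w _) (σ-length u) ⟩
    block w (offset +ᶻ j *ᶻ + 2) (length u * 2)    ≡⟨ σ-block j (length u) ⟩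
    σ (block preimage j (length u))                ≡⟨ cong σ e ⟩
    σ u                                            ∎)
    where open ≡-Reasoning

  preimage-admissible : Admissible w → Admissible preimage
  preimage-admissible (avoids , no-11) = avoids′ , no-0000 (avoids , no-11) ∘ σ-factor
    where
    σ-abab : ∀ a b → σ (a ++ b ++ a ++ b) ≡ σ a ++ σ b ++ σ a ++ σ b
    σ-abab a b = trans (σ-++ a _) (cong (σ a ++_) (trans (σ-++ b _) (cong (σ b ++_) (σ-++ a b))))
    avoids′ : AvoidsAAABABBB preimage
    avoids′ (a , b , a≢[] , b≢[] , aa , abab , bb) =
      avoids (σ a , σ b , σ-nonempty a≢[] , σ-nonempty b≢[] ,
        subst (λ v → FactorBi v w) (σ-++ a a) (σ-factor aa) ,
        subst (λ v → FactorBi v w) (σ-abab a b) (σ-factor abab) ,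
        subst (λ v → FactorBi v w) (σ-++ b b) (σ-factor bb))

  factor-inside-σ : ∀ {u} → FactorBi u w →
    ∃ λ v → FactorBi v preimage × length v ≡ suc ⌊ length u /2⌋ × ∃₂ λ x y → x ++ u ++ y ≡ σ v
  factor-inside-σ {u} (i , e) with even-odd-split offset i
  ... | j , o , o≤1 , i≡ =
    block preimage j m , block-factor preimage j m , block-length preimage j m , x , y , (begin
      x ++ u ++ y                       ≡⟨ cong (λ t → x ++ t ++ y) e ⟨
      x ++ block w i n ++ y             ≡⟨ cong (λ k → x ++ block w k n ++ y) i≡ ⟩
      x ++ block w (p +ᶻ + o) n ++ y    ≡⟨ cong (x ++_) (block-++ w (p +ᶻ + o) n r) ⟨
      x ++ block w (p +ᶻ + o) (n + r)   ≡⟨ block-++ w p o (n + r) ⟨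
      block w p (o + (n + r))           ≡⟨ cong (block w p) fits ⟩
      block w p (m * 2)                 ≡⟨ σ-block j m ⟩
      σ (block preimage j m)            ∎)
    where
    open ≡-Reasoning
    n = length u
    m = suc ⌊ n /2⌋
    p = offset +ᶻ j *ᶻ + 2
    r = m * 2 ∸ (o + n)
    x = block w p o
    y = block w (p +ᶻ + o +ᶻ + n) r
    fits : o + (n + r) ≡ m * 2
    fits = trans (sym (ℕ.+-assoc o n r))
                 (ℕ.m+[n∸m]≡n (ℕ.≤-trans (ℕ.+-monoˡ-≤ n o≤1) (n<[1+⌊n/2⌋]*2 n)))

admissible-desubstitution : ∀ {w} → Admissible w → Desubstitution w
admissible-desubstitution {w} adm = record
  { offset   = b
  ; preimage = λ j → not (w (b +ᶻ j *ᶻ + 2 +ᶻ + 1))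
  ; σ-block  = zeros⇒σ-blocks w b zeros
  }
  where
  marked-start : ∃ λ c → T (marked w c)
  marked-start with marked-near-origin adm
  ... | inj₁ m = + 0 , m
  ... | inj₂ m = + 1 , m
  c = proj₁ marked-start
  b = c +ᶻ + 1
  shift : ∀ c j → c +ᶻ j *ᶻ + 2 +ᶻ + 1 ≡ c +ᶻ + 1 +ᶻ j *ᶻ + 2
  shift = solve-∀
  zeros : ∀ j → w (b +ᶻ j *ᶻ + 2) ≡ O
  zeros j = subst (λ k → w k ≡ O) (shift c j) (marked-gap adm _
    (subst T (sym (periodic⇒constant (marked w) (+ 2) (marked-periodic adm) c j)) (proj₂ marked-start)))

FactorPD-σ : ∀ {v} → FactorPD v → FactorPD (σ v)
FactorPD-σ {v} (k , p , s , e) = suc k , σ p , σ s , (begin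
  σ p ++ σ v ++ σ s        ≡⟨ cong (σ p ++_) (σ-++ v s) ⟨
  σ p ++ σ (v ++ s)        ≡⟨ σ-++ p (v ++ s) ⟨
  σ (p ++ v ++ s)          ≡⟨ cong σ e ⟩
  σ (σ^ k (O ∷ []))        ∎)
  where open ≡-Reasoning

FactorPD-infix : ∀ x u y → FactorPD (x ++ u ++ y) → FactorPD u
FactorPD-infix x u y (k , p , s , e) = k , p ++ x , y ++ s , (begin
  (p ++ x) ++ u ++ y ++ s        ≡⟨ ++-assoc p x (u ++ y ++ s) ⟩
  p ++ x ++ u ++ y ++ s          ≡⟨ cong (λ t → p ++ x ++ t) (++-assoc u y s) ⟨
  p ++ x ++ (u ++ y) ++ s        ≡⟨ cong (p ++_) (++-assoc x (u ++ y) s) ⟨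
  p ++ (x ++ u ++ y) ++ s        ≡⟨ e ⟩
  σ^ k (O ∷ [])                  ∎)
  where open ≡-Reasoning

σ^-factor : ∀ k {w} → Admissible w → FactorBi (σ^ k (O ∷ [])) w
σ^-factor zero {w} adm with w (+ 0) in e₀ | w (+ 1) in e₁
... | O | _ = + 0 , cong (_∷ []) e₀
... | I | O = + 1 , cong (_∷ []) e₁
... | I | I = ⊥-elim (proj₂ adm (+ 0 , cong₂ (λ x y → x ∷ y ∷ []) e₀ e₁))
σ^-factor (suc k) adm = σ-factor D (σ^-factor k (preimage-admissible D adm))
  where D = admissible-desubstitution adm

admissible-factor⇒FactorPD : ∀ n w → Admissible w → ∀ u → length u ≡ n → FactorBi u w → FactorPD u
admissible-factor⇒FactorPD = <-rec _ λ where
  _ rec w adm []                 _    _ → 0 , [] , O ∷ [] , refl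
  _ rec w adm (O ∷ [])           _    _ → 0 , [] , [] , refl
  _ rec w adm (I ∷ [])           _    _ → 2 , O ∷ [] , O ∷ O ∷ [] , refl
  _ rec w adm (O ∷ O ∷ [])       _    _ → 2 , O ∷ I ∷ [] , [] , refl
  _ rec w adm (O ∷ I ∷ [])       _    _ → 2 , [] , O ∷ O ∷ [] , refl
  _ rec w adm (I ∷ O ∷ [])       _    _ → 2 , O ∷ [] , O ∷ [] , refl
  _ rec w adm (I ∷ I ∷ [])       _    f → ⊥-elim (proj₂ adm f)
  _ rec w adm u@(_ ∷ _ ∷ _ ∷ u′) refl f →
    let D = admissible-desubstitution adm
        v , fv , |v| , x , y , e = factor-inside-σ D f
        shorter = subst (_< length u) (sym |v|) (s<s (s<s (ℕ.⌊n/2⌋<n (length u′))))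
    in FactorPD-infix x u y (subst FactorPD (sym e)
         (FactorPD-σ (rec shorter (Desubstitution.preimage D) (preimage-admissible D adm) v refl fv)))

theorem11 : (w : BiWord) → AvoidsAAABABBB w → ¬ FactorBi (true ∷ true ∷ []) w →
    (u : Word) → (FactorBi u w → FactorPD u) × (FactorPD u → FactorBi u w)
theorem11 w avoids no-11 u = admissible-factor⇒FactorPD _ w adm u refl , occurs
  where
  adm : Admissible w
  adm = avoids , no-11
  occurs : FactorPD u → FactorBi u w
  occurs (k , p , s , e) = factor-infix p u s (subst (λ t → FactorBi t w) (sym e) (σ^-factor k adm))
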